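{- Let $k\ge 1$. Let $\mathcal{H}$ be the bi-hypergraph obtained from $\mathcal{H}_{2k+1}$ by removing the edge $\{v_{2k+1,1},v_{2k+1,2},v_{2k+1,3}\}$ and adding the edges $\{v_{1,j},v_{2k+1,j},v_{2k+1,j+1}\}$ for all $j\in\{1,2,3\}$ (second indices taken modulo $3$ in $\{1,2,3\}$). Then $\mathcal{H}$ is minimal uncolorable.
   Context: A bi-hypergraph is a pair $(\mathcal{V},\mathcal{E})$ with $\mathcal{V}$ a finite set and $\mathcal{E}$ a family of subsets of $\mathcal{V}$ (edges). A proper coloring is a map $f:\mathcal{V}\to\mathbb{N}$ with $1<|\{f(v):v\in e\}|<|e|$ for every edge $e$; a bi-hypergraph is colorable if such $f$ exists. A subhypergraph is $(\mathcal{V}',\mathcal{E}')$ with $\mathcal{V}'\subseteq\mathcal{V}$, $\mathcal{E}'\subseteq\mathcal{E}$; a bi-hypergraph is minimal uncolorable if it is uncolorable but each of its proper subhypergraphs is colorable. For $k\ge 2$, let $V_i=\{v_{i,1},v_{i,2},v_{i,3}\}$ ($i\in[k]$) be pairwise disjoint sets, and write $v_{i,4}=v_{i,1}$, $v_{i,5}=v_{i,2}$. The bi-hypergraph $\mathcal{H}_k$ has vertex set $V_1\cup\cdots\cup V_k$ and edge set consisting of the edges $V_i$ for all $i\in[k]$, together with the edges $\{v_{q+1,j},v_{q,j},v_{q,j+t}\}$ for all $q\in[k-1]$, $j\in\{1,2,3\}$, $t\in\{1,2\}$. -}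

module Defs where

open import Data.Nat as ℕ using (ℕ; zero; suc; _*_; _<_)
open import Data.Fin as Fin using (Fin; zero; suc; inject₁; fromℕ)
import Data.Fin.Properties as FinP
open import Data.Product using (Σ; _×_; _,_)
import Data.Product.Properties as ProdP
open import Data.List using (List; []; _∷_; length; map; deduplicate; concatMap; allFin; cartesianProduct; _++_)
open import Data.List.Relation.Unary.All using (All)
open import Data.List.Relation.Binary.Subset.Propositional using (_⊆_)
open import Relation.Binary.Definitions using (DecidableEquality)
open import Relation.Nullary using (¬_)

-- The vertex set is a finite list of vertices, the edges are a
-- finite list of edges, each edge being a finite list of vertices (read as
-- the set of its elements).

record BiHypergraph (A : Set) : Set where
  constructor ⟨_,_⟩
  field
    vertices : List A
    edges    : List (List A)

open BiHypergraph public

WellFormed : {A : Set} → BiHypergraph A → Set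
WellFormed H = All (λ e → e ⊆ vertices H) (edges H)

module _ {A : Set} (_≟_ : DecidableEquality A) where

  size : List A → ℕ
  size e = length (deduplicate _≟_ e)

  numColors : (A → ℕ) → List A → ℕ
  numColors f e = length (deduplicate ℕ._≟_ (map f e))

  ProperColoring : BiHypergraph A → (A → ℕ) → Set
  ProperColoring H f =
    All (λ e → (1 < numColors f e) × (numColors f e < size e)) (edges H)

  Colorable : BiHypergraph A → Set
  Colorable H = Σ (A → ℕ) (ProperColoring H)

  Subhypergraph : BiHypergraph A → BiHypergraph A → Set
  Subhypergraph H' H =
    WellFormed H' × (vertices H' ⊆ vertices H) × (edges H' ⊆ edges H)

  ProperSubhypergraph : BiHypergraph A → BiHypergraph A → Set
  ProperSubhypergraph H' H =
    Subhypergraph H' H × ¬ ((vertices H ⊆ vertices H') × (edges H ⊆ edges H'))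

  MinimalUncolorable : BiHypergraph A → Set
  MinimalUncolorable H =
    ¬ Colorable H × (∀ H' → ProperSubhypergraph H' H → Colorable H')

-- The concrete bi-hypergraph.  Vertex v_{i,j} (i ∈ [m], j ∈ [3]) is
-- represented by (i - 1 , j - 1) : Fin m × Fin 3.

Vtx : ℕ → Set
Vtx m = Fin m × Fin 3

vtx-≟ : (m : ℕ) → DecidableEquality (Vtx m)
vtx-≟ m = ProdP.≡-dec FinP._≟_ FinP._≟_

next3 : Fin 3 → Fin 3
next3 zero = suc zero
next3 (suc zero) = suc (suc zero)
next3 (suc (suc zero)) = zero

layer : {m : ℕ} → Fin m → List (Vtx m)
layer i = (i , zero) ∷ (i , suc zero) ∷ (i , suc (suc zero)) ∷ []

-- Layers are indexed by
-- Fin (suc (2 * k)); layer index 0 is V_1, fromℕ (2 * k) is V_{2k+1}.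
H : (k : ℕ) → BiHypergraph (Vtx (suc (2 * k)))
H k = ⟨ verts , es ⟩
  where
    m = suc (2 * k)
    verts : List (Vtx m)
    verts = cartesianProduct (allFin m) (allFin 3)
    layerEdges : List (List (Vtx m))
    layerEdges = map (λ i → layer (inject₁ i)) (allFin (2 * k))
    -- {v_{q+1,j}, v_{q,j}, v_{q,j+t}} for q ∈ [2k], j ∈ [3], t ∈ {1,2}
    linkEdges : List (List (Vtx m))
    linkEdges = concatMap (λ q → concatMap (λ j →
        ((suc q , j) ∷ (inject₁ q , j) ∷ (inject₁ q , next3 j) ∷ [])
      ∷ ((suc q , j) ∷ (inject₁ q , j) ∷ (inject₁ q , next3 (next3 j)) ∷ [])
      ∷ []) (allFin 3)) (allFin (2 * k))
    newEdges : List (List (Vtx m))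
    newEdges = map (λ j → (zero , j) ∷ (fromℕ (2 * k) , j) ∷ (fromℕ (2 * k) , next3 j) ∷ [])
      (allFin 3)
    es : List (List (Vtx m))
    es = layerEdges ++ linkEdges ++ newEdges

module Submission where

-- A proper colouring gives each layer V_i (i ≤ 2k) exactly two colours, hence a pattern
-- (a, a, b) up to rotation.  The link edges from such a layer force the next layer, when it
-- also has two colours, to carry the swapped pattern (b, b, a) at the same positions, so the
-- patterns alternate along V_1, …, V_2k.  As 2k is even, V_2k carries (b, b, a), and its link
-- edges force colour a at the two positions j, j + 1 of V_{2k+1}; together with v_{1,j} of
-- colour a the closing edge {v_{1,j}, v_{2k+1,j}, v_{2k+1,j+1}} is monochromatic.
--
-- For minimality, every vertex lies on a link edge, so a proper subhypergraph misses an edge e.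
-- Removing e we colour layer by layer: the layers before and after the position of e alternate
-- between two fixed layer colourings, patched at that position.  Whether such a splice works
-- depends only on finitely many conditions on the fixed layers, which are checked by evaluation.

open import Defs
open import Data.Empty using (⊥; ⊥-elim)
open import Data.Fin as Fin using (Fin; zero; suc; toℕ; inject₁; fromℕ; fromℕ<)
open import Data.Fin.Properties using (toℕ-inject₁; toℕ-fromℕ; toℕ-fromℕ<; toℕ<n; toℕ-injective)
import Data.Fin.Properties as Fin using (all?; _≟_)
open import Data.List using (List; []; _∷_; map; concatMap; allFin)
import Data.List.Properties as List using (≡-dec)
open import Data.List.Membership.Propositional using (_∈_; find)
open import Data.List.Relation.Binary.Subset.Propositional using (_⊆_)
open import Data.List.Relation.Unary.All as All using (All; []; _∷_)
open import Data.List.Relation.Unary.All.Properties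
  using (++⁺; ++⁻ˡ; ++⁻ʳ; map⁺; map⁻; concat⁺; concat⁻; tabulate⁺; tabulate⁻; ¬All⇒Any¬)
open import Data.List.Relation.Unary.Any using (here; there)
open import Data.Nat as ℕ using (ℕ; zero; suc; _*_; _≤_; _<_; z≤n; z<s)
open import Data.Nat.Properties
  using (_<?_; *-suc; <-irrefl; <-asym; <-trans; <-cmp; <⇒≤; n<1+n; 1+n≢n; m≤n⇒m<n∨m≡n)
open import Data.Product using (Σ; ∃-syntax; _×_; _,_; proj₁; proj₂; uncurry)
open import Data.Product.Properties using (,-injectiveˡ; ,-injectiveʳ; ≡-dec)
open import Data.Sum using (_⊎_; inj₁; inj₂)
open import Function using (_∘_; id)
open import Function.Bundles using (_⇔_; mk⇔; Equivalence)
open import Relation.Binary.Definitions using (DecidableEquality; Tri; tri<; tri≈; tri>)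
open import Relation.Binary.PropositionalEquality
open import Relation.Nullary using (¬_; ¬?; Dec; yes; no; contradiction; _×-dec_; _→-dec_; map′)
open import Relation.Nullary.Decidable using (True; toWitness)

module _ {A : Set} (_≟_ : DecidableEquality A) where

  ProperEdge : (A → ℕ) → List A → Set
  ProperEdge f e = 1 < numColors _≟_ f e × numColors _≟_ f e < size _≟_ e

  size-distinct : ∀ {x y z} → x ≢ y → x ≢ z → y ≢ z → size _≟_ (x ∷ y ∷ z ∷ []) ≡ 3
  size-distinct {x} {y} {z} x≢y x≢z y≢z with y ≟ z | x ≟ y
  ... | yes y≡z | _ = contradiction y≡z y≢z
  ... | no _ | yes x≡y = contradiction x≡y x≢y
  ... | no _ | no _ with x ≟ z
  ... | yes x≡z = contradiction x≡z x≢z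
  ... | no _ = refl

  size-constant : ∀ x → size _≟_ (x ∷ x ∷ x ∷ []) ≡ 1
  size-constant x with x ≟ x
  ... | yes _ = refl
  ... | no x≢x = contradiction refl x≢x

colours : ℕ → ℕ → ℕ → ℕ
colours a b c = size ℕ._≟_ (a ∷ b ∷ c ∷ [])

record Bichromatic (a b c : ℕ) : Set where
  constructor bichromatic
  field
    many : 1 < colours a b c
    few  : colours a b c < 3

bichromatic? : ∀ a b c → Dec (Bichromatic a b c)
bichromatic? a b c = map′ (uncurry bichromatic) (λ (bichromatic many few) → many , few)
                          (1 <? colours a b c ×-dec colours a b c <? 3)

proper-triple⇔ : ∀ {A} (_≟_ : DecidableEquality A) (f : A → ℕ) {x y z} →
                 x ≢ y → x ≢ z → y ≢ z →
                 ProperEdge _≟_ f (x ∷ y ∷ z ∷ []) ⇔ Bichromatic (f x) (f y) (f z)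
proper-triple⇔ _≟_ f {x} {y} {z} x≢y x≢z y≢z = mk⇔
  (λ (many , few) → bichromatic many (subst (colours (f x) (f y) (f z) <_) three few))
  (λ (bichromatic many few) → many , subst (colours (f x) (f y) (f z) <_) (sym three) few)
  where
    three : size _≟_ (x ∷ y ∷ z ∷ []) ≡ 3
    three = size-distinct _≟_ x≢y x≢z y≢z

bichromatic-cong : ∀ {a b c a′ b′ c′} → a ≡ a′ → b ≡ b′ → c ≡ c′ →
                   Bichromatic a b c → Bichromatic a′ b′ c′
bichromatic-cong refl refl refl bic = bic

¬bichromatic-constant : ∀ a → ¬ Bichromatic a a a
¬bichromatic-constant a (bichromatic many _) = <-irrefl (sym (size-constant ℕ._≟_ a)) many

bichromatic-odd-one : ∀ {y a} → Bichromatic y a a → y ≢ a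
bichromatic-odd-one {a = a} bic refl = ¬bichromatic-constant a bic

bichromatic-dichotomy : ∀ {y a b} → a ≢ b → Bichromatic y a b → y ≡ a ⊎ y ≡ b
bichromatic-dichotomy {y} {a} {b} a≢b (bichromatic _ few) with y ℕ.≟ a | y ℕ.≟ b
... | yes y≡a | _ = inj₁ y≡a
... | no _ | yes y≡b = inj₂ y≡b
... | no y≢a | no y≢b = contradiction few (<-irrefl (size-distinct ℕ._≟_ y≢a y≢b a≢b))

bichromatic-forced : ∀ {y a b} → a ≢ b → Bichromatic y a a → Bichromatic y a b → y ≡ b
bichromatic-forced a≢b bic₁ bic₂ with bichromatic-dichotomy a≢b bic₂
... | inj₁ y≡a = contradiction y≡a (bichromatic-odd-one bic₁)
... | inj₂ y≡b = y≡b

Layer : Set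
Layer = Fin 3 → ℕ

prev3 : Fin 3 → Fin 3
prev3 j = next3 (next3 j)

next3-prev3 : ∀ j → next3 (prev3 j) ≡ j
next3-prev3 zero = refl
next3-prev3 (suc zero) = refl
next3-prev3 (suc (suc zero)) = refl

all-positions : ∀ {P : Fin 3 → Set} j → P j → P (next3 j) → P (prev3 j) → ∀ i → P i
all-positions zero p₀ p₁ p₂ zero = p₀
all-positions zero p₀ p₁ p₂ (suc zero) = p₁
all-positions zero p₀ p₁ p₂ (suc (suc zero)) = p₂
all-positions (suc zero) p₁ p₂ p₀ zero = p₀
all-positions (suc zero) p₁ p₂ p₀ (suc zero) = p₁
all-positions (suc zero) p₁ p₂ p₀ (suc (suc zero)) = p₂
all-positions (suc (suc zero)) p₂ p₀ p₁ zero = p₀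
all-positions (suc (suc zero)) p₂ p₀ p₁ (suc zero) = p₁
all-positions (suc (suc zero)) p₂ p₀ p₁ (suc (suc zero)) = p₂

shift : Fin 2 → Fin 3 → Fin 3
shift zero = next3
shift (suc zero) = prev3

shift-≢ : ∀ t j → j ≢ shift t j
shift-≢ zero zero ()
shift-≢ zero (suc zero) ()
shift-≢ zero (suc (suc zero)) ()
shift-≢ (suc zero) zero ()
shift-≢ (suc zero) (suc zero) ()
shift-≢ (suc zero) (suc (suc zero)) ()

BichromaticLayer : Layer → Set
BichromaticLayer X = Bichromatic (X zero) (X (suc zero)) (X (suc (suc zero)))

-- The edge {v_{q+1,j}, v_{q,j}, v_{q,j+1+t}} when X and Y colour the layers q and q + 1.
LinkAt : Layer → Layer → Fin 3 → Fin 2 → Set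
LinkAt X Y j t = Bichromatic (Y j) (X j) (X (shift t j))

Link : Layer → Layer → Set
Link X Y = ∀ j t → LinkAt X Y j t

NewAt : Layer → Layer → Fin 3 → Set
NewAt X U j = Bichromatic (X j) (U j) (U (next3 j))

New : Layer → Layer → Set
New X U = ∀ j → NewAt X U j

LinkExcept : Fin 3 → Fin 2 → Layer → Layer → Set
LinkExcept j₀ t₀ X Y = ∀ j t → (j , t) ≢ (j₀ , t₀) → LinkAt X Y j t

NewExcept : Fin 3 → Layer → Layer → Set
NewExcept j₀ X U = ∀ j → j ≢ j₀ → NewAt X U j

-- Uncolourability

record Pattern (j : Fin 3) (a b : ℕ) (X : Layer) : Set where
  field
    a≢b     : a ≢ b
    at-j    : X j ≡ a
    at-next : X (next3 j) ≡ a
    at-prev : X (prev3 j) ≡ b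

pattern-exists : ∀ {X} → BichromaticLayer X → ∃[ j ] ∃[ a ] ∃[ b ] Pattern j a b X
pattern-exists {X} bic@(bichromatic _ few)
  with X zero ℕ.≟ X (suc zero)
     | X (suc zero) ℕ.≟ X (suc (suc zero))
     | X (suc (suc zero)) ℕ.≟ X zero
... | yes x₀≡x₁ | yes x₁≡x₂ | _ =
  contradiction (bichromatic-cong refl (sym x₀≡x₁) (sym (trans x₀≡x₁ x₁≡x₂)) bic) (¬bichromatic-constant _)
... | yes x₀≡x₁ | no x₁≢x₂ | _ = zero , _ , _ , record
  { a≢b = λ x₀≡x₂ → x₁≢x₂ (trans (sym x₀≡x₁) x₀≡x₂)
  ; at-j = refl ; at-next = sym x₀≡x₁ ; at-prev = refl }
... | no x₀≢x₁ | yes x₁≡x₂ | _ = suc zero , _ , _ , record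
  { a≢b = x₀≢x₁ ∘ sym ; at-j = refl ; at-next = sym x₁≡x₂ ; at-prev = refl }
... | no x₀≢x₁ | no _ | yes x₂≡x₀ = suc (suc zero) , _ , _ , record
  { a≢b = λ x₂≡x₁ → x₀≢x₁ (trans (sym x₂≡x₀) x₂≡x₁)
  ; at-j = refl ; at-next = sym x₂≡x₀ ; at-prev = refl }
... | no x₀≢x₁ | no x₁≢x₂ | no x₂≢x₀ =
  contradiction few (<-irrefl (size-distinct ℕ._≟_ x₀≢x₁ (x₂≢x₀ ∘ sym) x₁≢x₂))

module _ {j a b X Y} (p : Pattern j a b X) (link : Link X Y) where
  open Pattern p

  private
    forced : ∀ {y c d e} → c ≡ a → d ≡ a → e ≡ b → Bichromatic y c d → Bichromatic y c e → y ≡ b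
    forced c≡a d≡a e≡b bic₁ bic₂ =
      bichromatic-forced a≢b (bichromatic-cong refl c≡a d≡a bic₁) (bichromatic-cong refl c≡a e≡b bic₂)

  link-forces : Y j ≡ b × Y (next3 j) ≡ b
  link-forces =
    forced at-j at-next at-prev (link j zero) (link j (suc zero)) ,
    forced at-next (trans (cong X (next3-prev3 j)) at-j) at-prev
           (link (next3 j) (suc zero)) (link (next3 j) zero)

  link-propagates : BichromaticLayer Y → Pattern j b a Y
  link-propagates bic with bichromatic-dichotomy (a≢b ∘ sym)
    (bichromatic-cong refl at-prev (trans (cong X (next3-prev3 j)) at-j) (link (prev3 j) zero))
  ... | inj₁ y≡b =
    contradiction (bichromatic-cong (constant zero) (constant (suc zero)) (constant (suc (suc zero))) bic)
                  (¬bichromatic-constant b)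
    where
      constant : ∀ i → Y i ≡ b
      constant = all-positions {λ i → Y i ≡ b} j (proj₁ link-forces) (proj₂ link-forces) y≡b
  ... | inj₂ y≡a = record
    { a≢b = a≢b ∘ sym ; at-j = proj₁ link-forces ; at-next = proj₂ link-forces ; at-prev = y≡a }

alternate : {A : Set} → A → A → ℕ → A
alternate a b zero = a
alternate a b (suc n) = alternate b a n

Even Odd : ℕ → Set₁
Even n = ∀ {A : Set} {a b : A} → alternate a b n ≡ a
Odd n = ∀ {A : Set} {a b : A} → alternate a b n ≡ b

parity : ∀ n → Even n ⊎ Odd n
parity zero = inj₁ refl
parity (suc n) with parity n
... | inj₁ even = inj₂ even
... | inj₂ odd = inj₁ odd

¬even∧odd : ∀ {n} → Even n → Odd n → ⊥
¬even∧odd even odd with () ← trans (sym (even {ℕ} {0} {1})) odd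

even-double : ∀ m → Even (2 * m)
even-double zero = refl
even-double (suc m) {a = a} {b} = trans (cong (alternate a b) (*-suc 2 m)) (even-double m)

odd-before-double : ∀ {n} m → suc n ≡ 2 * m → Odd n
odd-before-double m n+1≡2m {a = a} {b} =
  subst (λ l → alternate b a l ≡ b) (sym n+1≡2m) (even-double m)

layered-uncolourable : ∀ k (g : ℕ → Layer) →
  (∀ n → n < 2 * suc k → BichromaticLayer (g n)) →
  (∀ n → n < 2 * suc k → Link (g n) (g (suc n))) →
  ¬ New (g 0) (g (2 * suc k))
layered-uncolourable k g layers-bichromatic linked new
  with j , a , b , p₀ ← pattern-exists (layers-bichromatic 0 z<s) =
  ¬bichromatic-constant a (bichromatic-cong (Pattern.at-j p₀) (proj₁ last-at) (proj₂ last-at) (new j))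
  where
    along : ∀ n → n < 2 * suc k → Pattern j (alternate a b n) (alternate b a n) (g n)
    along zero _ = p₀
    along (suc n) n+1<last =
      link-propagates (along n (<⇒≤ n+1<last)) (linked n (<⇒≤ n+1<last))
                      (layers-bichromatic (suc n) n+1<last)

    penultimate : ℕ
    penultimate = ℕ.pred (2 * suc k)

    last-at : g (2 * suc k) j ≡ a × g (2 * suc k) (next3 j) ≡ a
    last-at =
      let forced-j , forced-next =
            link-forces (along penultimate (n<1+n penultimate)) (linked penultimate (n<1+n penultimate))
      in trans forced-j (odd-before-double (suc k) refl) , trans forced-next (odd-before-double (suc k) refl)

-- Spliced colourings

alternate-preserves : ∀ {A : Set} {P : A → Set} {a b} → P a → P b → ∀ n → P (alternate a b n)
alternate-preserves pa pb zero = pa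
alternate-preserves {P = P} pa pb (suc n) = alternate-preserves {P = P} pb pa n

alternate-relates : ∀ {A : Set} {R : A → A → Set} {a₀ a₁ b₀ b₁} →
                    R a₀ b₁ → R a₁ b₀ → ∀ n → R (alternate a₀ a₁ n) (alternate b₀ b₁ (suc n))
alternate-relates r₀₁ r₁₀ zero = r₀₁
alternate-relates {R = R} r₀₁ r₁₀ (suc n) = alternate-relates {R = R} r₁₀ r₀₁ n

Phase : Set
Phase = Layer × Layer

_⟨_⟩ : Phase → ℕ → Layer
(A , B) ⟨ n ⟩ = alternate A B n

BichromaticPhase : Phase → Set
BichromaticPhase (A , B) = BichromaticLayer A × BichromaticLayer B

Linked : Phase → Phase → Set
Linked (A₀ , A₁) (B₀ , B₁) = Link A₀ B₁ × Link A₁ B₀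

bichromaticLayer? : ∀ X → Dec (BichromaticLayer X)
bichromaticLayer? X = bichromatic? _ _ _

link? : ∀ X Y → Dec (Link X Y)
link? X Y = Fin.all? λ j → Fin.all? λ t → bichromatic? _ _ _

new? : ∀ X U → Dec (New X U)
new? X U = Fin.all? λ j → bichromatic? _ _ _

linkExcept? : ∀ j₀ t₀ X Y → Dec (LinkExcept j₀ t₀ X Y)
linkExcept? j₀ t₀ X Y =
  Fin.all? λ j → Fin.all? λ t → ¬? (≡-dec Fin._≟_ Fin._≟_ (j , t) (j₀ , t₀)) →-dec bichromatic? _ _ _

newExcept? : ∀ j₀ X U → Dec (NewExcept j₀ X U)
newExcept? j₀ X U = Fin.all? λ j → ¬? (j Fin.≟ j₀) →-dec bichromatic? _ _ _

bichromaticPhase? : ∀ A → Dec (BichromaticPhase A)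
bichromaticPhase? (A , B) = bichromaticLayer? A ×-dec bichromaticLayer? B

linked? : ∀ A B → Dec (Linked A B)
linked? (A₀ , A₁) (B₀ , B₁) = link? A₀ B₁ ×-dec link? A₁ B₀

-- Layer n gets before ⟨ n ⟩ for n < q₀, at ⟨ n ⟩ for n = q₀, after ⟨ n ⟩ for q₀ < n < last
-- and final for n = last (Layered.Spliced.colour); the phases follow the parity of n itself.
record Splice : Set where
  field
    before at after : Phase
    final           : Layer

through : Layer → Layer → Layer → Layer → Layer → Splice
through p q x y u = record { before = p , q ; at = p , q ; after = x , y ; final = u }

record Admissible (s : Splice) : Set where
  open Splice s
  field
    before-bichromatic : True (bichromaticPhase? before)
    after-bichromatic  : True (bichromaticPhase? after)
    before-linked      : True (linked? before before)
    entry-linked       : True (linked? before at)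
    after-linked       : True (linked? after after)
    final-linked       : True (link? (proj₂ after) final)

record LayerRemovable (s : Splice) : Set where
  open Splice s
  field
    admissible     : Admissible s
    leave-linked   : True (linked? at after)
    leave-final    : True (link? (proj₂ at) final)
    closing-before : True (new? (proj₁ before) final)
    closing-at     : True (new? (proj₁ at) final)

record EvenLinkRemovable (j₀ : Fin 3) (t₀ : Fin 2) (s : Splice) : Set where
  open Splice s
  field
    admissible     : Admissible s
    at-bichromatic : True (bichromaticLayer? (proj₁ at))
    leave-except   : True (linkExcept? j₀ t₀ (proj₁ at) (proj₂ after))
    closing-before : True (new? (proj₁ before) final)
    closing-at     : True (new? (proj₁ at) final)

record OddLinkRemovable (j₀ : Fin 3) (t₀ : Fin 2) (s : Splice) : Set where
  open Splice s
  field
    admissible         : Admissible s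
    at-bichromatic     : True (bichromaticLayer? (proj₂ at))
    leave-except       : True (linkExcept? j₀ t₀ (proj₂ at) (proj₁ after))
    leave-final-except : True (linkExcept? j₀ t₀ (proj₂ at) final)
    closing-before     : True (new? (proj₁ before) final)
    closing-at         : True (new? (proj₁ at) final)

record NewRemovable (j₀ : Fin 3) (s : Splice) : Set where
  open Splice s
  field
    admissible     : Admissible s
    at-bichromatic : True (bichromaticLayer? (proj₁ at))
    leave-linked   : True (link? (proj₁ at) (proj₂ after))
    closing-before : True (newExcept? j₀ (proj₁ before) final)
    closing-at     : True (newExcept? j₀ (proj₁ at) final)

clamp : ∀ {m} → ℕ → Fin (suc m)
clamp {zero} _ = zero
clamp {suc m} zero = zero
clamp {suc m} (suc n) = suc (clamp n)

clamp-toℕ : ∀ {m} (i : Fin (suc m)) → clamp (toℕ i) ≡ i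
clamp-toℕ {zero} zero = refl
clamp-toℕ {suc m} zero = refl
clamp-toℕ {suc m} (suc i) = cong suc (clamp-toℕ i)

every-index : ∀ {m} {P : ℕ → Set} → (∀ (i : Fin m) → P (toℕ i)) → ∀ n → n < m → P n
every-index {P = P} h n n<m = subst P (toℕ-fromℕ< n<m) (h (fromℕ< n<m))

suc≢inject₁ : ∀ {m} (i : Fin m) → suc i ≢ inject₁ i
suc≢inject₁ i i+1≡i = 1+n≢n (trans (cong toℕ i+1≡i) (toℕ-inject₁ i))

-- The paper's k is suc k here, so that the layers are 0, …, last = 2 * suc k.
module Layered (k : ℕ) where

  last : ℕ
  last = 2 * suc k

  V : Set
  V = Vtx (suc last)

  ℋ : BiHypergraph V
  ℋ = H (suc k)

  layerEdge : Fin last → List V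
  layerEdge i = layer (inject₁ i)

  linkEdge : Fin last → Fin 3 → Fin 2 → List V
  linkEdge q j t = (suc q , j) ∷ (inject₁ q , j) ∷ (inject₁ q , shift t j) ∷ []

  newEdge : Fin 3 → List V
  newEdge j = (zero , j) ∷ (fromℕ last , j) ∷ (fromℕ last , next3 j) ∷ []

  record EachEdge (P : List V → Set) : Set where
    field
      on-layer : ∀ i → P (layerEdge i)
      on-link  : ∀ q j t → P (linkEdge q j t)
      on-new   : ∀ j → P (newEdge j)

  private
    linkPair : Fin last → Fin 3 → List (List V)
    linkPair q j = linkEdge q j zero ∷ linkEdge q j (suc zero) ∷ []

    layerEdges linkEdges newEdges : List (List V)
    layerEdges = map layerEdge (allFin last)
    linkEdges = concatMap (λ q → concatMap (linkPair q) (allFin 3)) (allFin last)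
    newEdges = map newEdge (allFin 3)

  each⇒all : ∀ {P} → EachEdge P → All P (edges ℋ)
  each⇒all {P} each = ++⁺ layers (++⁺ links news)
    where
      open EachEdge each

      layers : All P layerEdges
      layers = map⁺ {f = layerEdge} (tabulate⁺ on-layer)

      links : All P linkEdges
      links = concat⁺ (map⁺ {f = λ q → concatMap (linkPair q) (allFin 3)} (tabulate⁺ λ q →
                concat⁺ (map⁺ {f = linkPair q} (tabulate⁺ λ j → on-link q j zero ∷ on-link q j (suc zero) ∷ []))))

      news : All P newEdges
      news = map⁺ {f = newEdge} (tabulate⁺ on-new)

  all⇒each : ∀ {P} → All P (edges ℋ) → EachEdge P
  all⇒each {P} all = record
    { on-layer = tabulate⁻ (map⁻ {f = layerEdge} layers)
    ; on-link  = λ where q j zero → All.head (pairs q j)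
                         q j (suc zero) → All.head (All.tail (pairs q j))
    ; on-new   = tabulate⁻ (map⁻ {f = newEdge} news)
    }
    where
      layers : All P layerEdges
      layers = ++⁻ˡ layerEdges all

      links : All P linkEdges
      links = ++⁻ˡ linkEdges (++⁻ʳ layerEdges all)

      news : All P newEdges
      news = ++⁻ʳ linkEdges (++⁻ʳ layerEdges all)

      pairs : ∀ q j → All P (linkPair q j)
      pairs q j = tabulate⁻ {f = id} (map⁻ {f = linkPair q} (concat⁻ (tabulate⁻ {f = id}
                    (map⁻ {f = λ q → concatMap (linkPair q) (allFin 3)} (concat⁻ links)) q))) j

  ProperEdgeOf : (V → ℕ) → List V → Set
  ProperEdgeOf = ProperEdge (vtx-≟ (suc last))

  _represents_ : (V → ℕ) → (ℕ → Layer) → Set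
  f represents L = ∀ i j → f (i , j) ≡ L (toℕ i) j

  colourBy : (ℕ → Layer) → V → ℕ
  colourBy L (i , j) = L (toℕ i) j

  layersOf : (V → ℕ) → ℕ → Layer
  layersOf f n j = f (clamp n , j)

  colourBy-represents : ∀ L → colourBy L represents L
  colourBy-represents L _ _ = refl

  layersOf-represents : ∀ f → f represents layersOf f
  layersOf-represents f i j = cong (λ i → f (i , j)) (sym (clamp-toℕ i))

  module Represented {f : V → ℕ} {L : ℕ → Layer} (rep : f represents L) where

    private
      represented⇔ : ∀ {x y z a b c} → x ≢ y → x ≢ z → y ≢ z → f x ≡ a → f y ≡ b → f z ≡ c →
                     ProperEdgeOf f (x ∷ y ∷ z ∷ []) ⇔ Bichromatic a b c
      represented⇔ x≢y x≢z y≢z refl refl refl = proper-triple⇔ (vtx-≟ (suc last)) f x≢y x≢z y≢z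

      rep-inject₁ : ∀ i j → f (inject₁ i , j) ≡ L (toℕ i) j
      rep-inject₁ i j = trans (rep _ j) (cong (λ n → L n j) (toℕ-inject₁ i))

      rep-last : ∀ j → f (fromℕ last , j) ≡ L last j
      rep-last j = trans (rep _ j) (cong (λ n → L n j) (toℕ-fromℕ last))

    layerEdge⇔ : ∀ i → ProperEdgeOf f (layerEdge i) ⇔ BichromaticLayer (L (toℕ i))
    layerEdge⇔ i =
      represented⇔ (λ ()) (λ ()) (λ ()) (rep-inject₁ i _) (rep-inject₁ i _) (rep-inject₁ i _)

    linkEdge⇔ : ∀ q j t → ProperEdgeOf f (linkEdge q j t) ⇔ LinkAt (L (toℕ q)) (L (suc (toℕ q))) j t
    linkEdge⇔ q j t = represented⇔ (suc≢inject₁ q ∘ ,-injectiveˡ) (suc≢inject₁ q ∘ ,-injectiveˡ)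
                                   (shift-≢ t j ∘ ,-injectiveʳ) (rep (suc q) j) (rep-inject₁ q j) (rep-inject₁ q _)

    newEdge⇔ : ∀ j → ProperEdgeOf f (newEdge j) ⇔ NewAt (L 0) (L last) j
    newEdge⇔ j =
      represented⇔ (λ ()) (λ ()) (shift-≢ zero j ∘ ,-injectiveʳ) (rep zero j) (rep-last j) (rep-last _)

  uncolourable : ¬ Colorable (vtx-≟ (suc last)) ℋ
  uncolourable (f , proper) = layered-uncolourable k (layersOf f)
    (every-index λ i → Equivalence.to (layerEdge⇔ i) (on-layer i))
    (every-index λ q j t → Equivalence.to (linkEdge⇔ q j t) (on-link q j t))
    (λ j → Equivalence.to (newEdge⇔ j) (on-new j))
    where
      open EachEdge (all⇒each proper)
      open Represented {f} {layersOf f} (layersOf-represents f)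

  ColourableWithout : List V → Set
  ColourableWithout e = Σ (V → ℕ) λ f → All (λ e′ → e′ ≢ e → ProperEdgeOf f e′) (edges ℋ)

  layered-colourable-without : ∀ {e} (L : ℕ → Layer) →
    (∀ i → layerEdge i ≢ e → BichromaticLayer (L (toℕ i))) →
    (∀ q j t → linkEdge q j t ≢ e → LinkAt (L (toℕ q)) (L (suc (toℕ q))) j t) →
    (∀ j → newEdge j ≢ e → NewAt (L 0) (L last) j) →
    ColourableWithout e
  layered-colourable-without L layers links news = colourBy L , each⇒all record
    { on-layer = λ i i≢e → Equivalence.from (layerEdge⇔ i) (layers i i≢e)
    ; on-link  = λ q j t q≢e → Equivalence.from (linkEdge⇔ q j t) (links q j t q≢e)
    ; on-new   = λ j j≢e → Equivalence.from (newEdge⇔ j) (news j j≢e)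
    }
    where open Represented {colourBy L} {L} (colourBy-represents L)

  module Spliced (s : Splice) (q₀ : Fin last) where
    open Splice s

    q : ℕ
    q = toℕ q₀

    q<last : q < last
    q<last = toℕ<n q₀

    colour : ℕ → Layer
    colour n with n ℕ.≟ last | <-cmp n q
    ... | yes _ | _ = final
    ... | no _ | tri< _ _ _ = before ⟨ n ⟩
    ... | no _ | tri≈ _ _ _ = at ⟨ n ⟩
    ... | no _ | tri> _ _ _ = after ⟨ n ⟩

    colour-final : colour last ≡ final
    colour-final with last ℕ.≟ last | <-cmp last q
    ... | yes _ | _ = refl
    ... | no last≢last | _ = contradiction refl last≢last

    colour-before : ∀ {n} → n < q → colour n ≡ before ⟨ n ⟩
    colour-before {n} n<q with n ℕ.≟ last | <-cmp n q
    ... | yes refl | _ = contradiction (<-trans n<q q<last) (<-irrefl refl)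
    ... | no _ | tri< _ _ _ = refl
    ... | no _ | tri≈ _ n≡q _ = contradiction n<q (<-irrefl n≡q)
    ... | no _ | tri> _ _ q<n = contradiction q<n (<-asym n<q)

    colour-at : colour q ≡ at ⟨ q ⟩
    colour-at with q ℕ.≟ last | <-cmp q q
    ... | yes q≡last | _ = contradiction q<last (<-irrefl q≡last)
    ... | no _ | tri< q<q _ _ = contradiction q<q (<-irrefl refl)
    ... | no _ | tri≈ _ _ _ = refl
    ... | no _ | tri> _ _ q<q = contradiction q<q (<-irrefl refl)

    colour-after : ∀ {n} → q < n → n < last → colour n ≡ after ⟨ n ⟩
    colour-after {n} q<n n<last with n ℕ.≟ last | <-cmp n q
    ... | yes n≡last | _ = contradiction n<last (<-irrefl n≡last)
    ... | no _ | tri< n<q _ _ = contradiction q<n (<-asym n<q)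
    ... | no _ | tri≈ _ n≡q _ = contradiction q<n (<-irrefl (sym n≡q))
    ... | no _ | tri> _ _ _ = refl

    colour-next-even : Even q → colour (suc q) ≡ proj₂ after
    colour-next-even even with m≤n⇒m<n∨m≡n q<last
    ... | inj₁ q+1<last = trans (colour-after (n<1+n q) q+1<last) even
    ... | inj₂ q+1≡last = ⊥-elim (¬even∧odd {q} even (odd-before-double (suc k) q+1≡last))

    colour-next-odd : Odd q → colour (suc q) ≡ proj₁ after ⊎ colour (suc q) ≡ final
    colour-next-odd odd with m≤n⇒m<n∨m≡n q<last
    ... | inj₁ q+1<last = inj₁ (trans (colour-after (n<1+n q) q+1<last) odd)
    ... | inj₂ q+1≡last = inj₂ (trans (cong colour q+1≡last) colour-final)

    at-even : ∀ {S : Layer → Set} → Even q → S (proj₁ at) → S (colour q)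
    at-even {S} even = subst S (sym (trans colour-at even))

    at-odd : ∀ {S : Layer → Set} → Odd q → S (proj₂ at) → S (colour q)
    at-odd {S} odd = subst S (sym (trans colour-at odd))

    across-even : ∀ {R : Layer → Layer → Set} → Even q →
                  R (proj₁ at) (proj₂ after) → R (colour q) (colour (suc q))
    across-even {R} even = subst₂ R (sym (trans colour-at even)) (sym (colour-next-even even))

    across-odd : ∀ {R : Layer → Layer → Set} → Odd q →
                 R (proj₂ at) (proj₁ after) → R (proj₂ at) final → R (colour q) (colour (suc q))
    across-odd {R} odd r-after r-final with colour-next-odd odd
    ... | inj₁ next≡after = subst₂ R (sym (trans colour-at odd)) (sym next≡after) r-after
    ... | inj₂ next≡final = subst₂ R (sym (trans colour-at odd)) (sym next≡final) r-final

    across : Linked at after → Link (proj₂ at) final → Link (colour q) (colour (suc q))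
    across (link₀ , link₁) link-final with parity q
    ... | inj₁ even = across-even {Link} even link₀
    ... | inj₂ odd = across-odd {Link} odd link₁ link-final

    ends : ∀ {R : Layer → Layer → Set} →
           R (proj₁ before) final → R (proj₁ at) final → R (colour 0) (colour last)
    ends {R} r-before r-at with m≤n⇒m<n∨m≡n (z≤n {q})
    ... | inj₁ 0<q = subst₂ R (sym (colour-before 0<q)) (sym colour-final) r-before
    ... | inj₂ 0≡q =
      subst₂ R (sym (subst (λ n → colour n ≡ at ⟨ n ⟩) (sym 0≡q) colour-at)) (sym colour-final) r-at

    module _ (admissible : Admissible s) where
      open Admissible admissible

      bichromatic-away : ∀ n → n < last → n ≢ q → BichromaticLayer (colour n)
      bichromatic-away n n<last n≢q = by-order (<-cmp n q)
        where
          by-order : Tri (n < q) (n ≡ q) (q < n) → BichromaticLayer (colour n)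
          by-order (tri< n<q _ _) = subst BichromaticLayer (sym (colour-before n<q))
            (uncurry (alternate-preserves {P = BichromaticLayer}) (toWitness before-bichromatic) n)
          by-order (tri≈ _ n≡q _) = contradiction n≡q n≢q
          by-order (tri> _ _ q<n) = subst BichromaticLayer (sym (colour-after q<n n<last))
            (uncurry (alternate-preserves {P = BichromaticLayer}) (toWitness after-bichromatic) n)

      link-away : ∀ n → n < last → n ≢ q → Link (colour n) (colour (suc n))
      link-away n n<last n≢q = by-order (<-cmp n q)
        where
          colour-entry : suc n ≡ q → colour (suc n) ≡ at ⟨ suc n ⟩
          colour-entry n+1≡q = subst (λ m → colour m ≡ at ⟨ m ⟩) (sym n+1≡q) colour-at

          colour-exit : suc n ≡ last → colour (suc n) ≡ final
          colour-exit n+1≡last = trans (cong colour n+1≡last) colour-final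

          by-order : Tri (n < q) (n ≡ q) (q < n) → Link (colour n) (colour (suc n))
          by-order (tri≈ _ n≡q _) = contradiction n≡q n≢q
          by-order (tri< n<q _ _) with m≤n⇒m<n∨m≡n n<q
          ... | inj₁ n+1<q = subst₂ Link (sym (colour-before n<q)) (sym (colour-before n+1<q))
                  (uncurry (alternate-relates {R = Link}) (toWitness before-linked) n)
          ... | inj₂ n+1≡q = subst₂ Link (sym (colour-before n<q)) (sym (colour-entry n+1≡q))
                  (uncurry (alternate-relates {R = Link}) (toWitness entry-linked) n)
          by-order (tri> _ _ q<n) with m≤n⇒m<n∨m≡n n<last
          ... | inj₁ n+1<last = subst₂ Link (sym (colour-after q<n n<last))
                  (sym (colour-after (<-trans q<n (n<1+n n)) n+1<last))
                  (uncurry (alternate-relates {R = Link}) (toWitness after-linked) n)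
          ... | inj₂ n+1≡last =
                  subst₂ Link (sym (trans (colour-after q<n n<last) (odd-before-double (suc k) n+1≡last)))
                         (sym (colour-exit n+1≡last)) (toWitness final-linked)

      spliced-colourable-without : ∀ {e} →
        (layerEdge q₀ ≢ e → BichromaticLayer (colour q)) →
        (∀ j t → linkEdge q₀ j t ≢ e → LinkAt (colour q) (colour (suc q)) j t) →
        (∀ j → newEdge j ≢ e → NewAt (colour 0) (colour last) j) →
        ColourableWithout e
      spliced-colourable-without {e} layer-q₀ link-q₀ news =
        layered-colourable-without colour layers links news
        where
          layers : ∀ i → layerEdge i ≢ e → BichromaticLayer (colour (toℕ i))
          layers i i≢e with i Fin.≟ q₀
          ... | yes refl = layer-q₀ i≢e
          ... | no i≢q₀ = bichromatic-away (toℕ i) (toℕ<n i) (i≢q₀ ∘ toℕ-injective)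

          links : ∀ p j t → linkEdge p j t ≢ e → LinkAt (colour (toℕ p)) (colour (suc (toℕ p))) j t
          links p j t p≢e with p Fin.≟ q₀
          ... | yes refl = link-q₀ j t p≢e
          ... | no p≢q₀ = link-away (toℕ p) (toℕ<n p) (p≢q₀ ∘ toℕ-injective) j t

  without-layer : ∀ {s} → LayerRemovable s → ∀ q₀ → ColourableWithout (layerEdge q₀)
  without-layer {s} removable q₀ = spliced-colourable-without admissible
    (λ q₀≢q₀ → contradiction refl q₀≢q₀)
    (λ j t _ → across (toWitness leave-linked) (toWitness leave-final) j t)
    (λ j _ → ends {New} (toWitness closing-before) (toWitness closing-at) j)
    where
      open Spliced s q₀
      open LayerRemovable removable

  without-link : ∀ {s s′ j₀ t₀} → EvenLinkRemovable j₀ t₀ s → OddLinkRemovable j₀ t₀ s′ →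
                 ∀ q₀ → ColourableWithout (linkEdge q₀ j₀ t₀)
  without-link {s} {s′} {j₀} {t₀} even-removable odd-removable q₀ with parity (toℕ q₀)
  ... | inj₁ even = spliced-colourable-without admissible
    (λ _ → at-even {BichromaticLayer} even (toWitness at-bichromatic))
    (λ j t ≢e → across-even {LinkExcept j₀ t₀} even (toWitness leave-except) j t λ { refl → ≢e refl })
    (λ j _ → ends {New} (toWitness closing-before) (toWitness closing-at) j)
    where
      open Spliced s q₀
      open EvenLinkRemovable even-removable
  ... | inj₂ odd = spliced-colourable-without admissible
    (λ _ → at-odd {BichromaticLayer} odd (toWitness at-bichromatic))
    (λ j t ≢e → across-odd {LinkExcept j₀ t₀} odd (toWitness leave-except) (toWitness leave-final-except) j t
                  λ { refl → ≢e refl })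
    (λ j _ → ends {New} (toWitness closing-before) (toWitness closing-at) j)
    where
      open Spliced s′ q₀
      open OddLinkRemovable odd-removable

  without-new : ∀ {s j₀} → NewRemovable j₀ s → ColourableWithout (newEdge j₀)
  without-new {s} {j₀} removable = spliced-colourable-without admissible
    (λ _ → at-even {BichromaticLayer} refl (toWitness at-bichromatic))
    (λ j t _ → across-even {Link} refl (toWitness leave-linked) j t)
    (λ j ≢e → ends {NewExcept j₀} (toWitness closing-before) (toWitness closing-at) j (≢e ∘ cong newEdge))
    where
      open Spliced s zero
      open NewRemovable removable

  vertex-on-link : ∀ i j → ∃[ q ] (i , j) ∈ linkEdge q j zero
  vertex-on-link zero j = zero , there (here refl)
  vertex-on-link (suc q) j = q , here refl

  open import Data.List.Membership.DecPropositional (List.≡-dec (vtx-≟ (suc last))) using (_∈?_)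

  proper-subhypergraphs-colourable : All ColourableWithout (edges ℋ) →
    ∀ H′ → ProperSubhypergraph (vtx-≟ (suc last)) H′ ℋ → Colorable (vtx-≟ (suc last)) H′
  proper-subhypergraphs-colourable without-each H′ ((well-formed , _ , E′⊆E) , not-everything)
    with All.all? (_∈? edges H′) (edges ℋ)
  ... | yes E⊆E′ = ⊥-elim (not-everything (covered , All.lookup E⊆E′))
    where
      covered : vertices ℋ ⊆ vertices H′
      covered {i , j} _ with q , v∈e ← vertex-on-link i j =
        All.lookup well-formed (EachEdge.on-link (all⇒each E⊆E′) q j zero) v∈e
  ... | no E⊈E′ =
    let e , e∈E , e∉E′ = find (¬All⇒Any¬ (_∈? edges H′) (edges ℋ) E⊈E′)
        f , proper = All.lookup without-each e∈E
    in f , All.tabulate λ e′∈E′ → All.lookup proper (E′⊆E e′∈E′) λ { refl → e∉E′ e′∈E′ }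

-- Splices found by a computer search.

tri : ℕ → ℕ → ℕ → Layer
tri a b c zero = a
tri a b c (suc zero) = b
tri a b c (suc (suc zero)) = c

layer-splice : Splice
layer-splice = record
  { before = tri 0 0 1 , tri 1 1 0 ; at = tri 0 0 0 , tri 1 1 1 ; after = tri 2 2 3 , tri 3 3 2 ; final = tri 2 2 2 }

layer-splice-removable : LayerRemovable layer-splice
layer-splice-removable = _

-- For t₀ = 0 no single splice serves both parities of q₀, hence two tables of link splices.
even-link-splice : Fin 3 → Fin 2 → Splice
even-link-splice zero zero = through (tri 0 1 0) (tri 1 0 1) (tri 1 2 2) (tri 2 1 1) (tri 2 2 2)
even-link-splice zero (suc zero) = through (tri 0 0 1) (tri 1 1 0) (tri 1 2 2) (tri 2 1 1) (tri 2 2 2)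
even-link-splice (suc zero) zero = through (tri 0 0 1) (tri 1 1 0) (tri 2 1 2) (tri 1 2 1) (tri 2 2 2)
even-link-splice (suc zero) (suc zero) = through (tri 0 0 1) (tri 1 1 0) (tri 0 1 0) (tri 1 0 1) (tri 0 1 0)
even-link-splice (suc (suc zero)) zero = through (tri 0 1 1) (tri 1 0 0) (tri 2 2 0) (tri 0 0 2) (tri 2 2 2)
even-link-splice (suc (suc zero)) (suc zero) = through (tri 0 1 0) (tri 1 0 1) (tri 2 2 1) (tri 1 1 2) (tri 2 2 2)

even-link-removable : ∀ j₀ t₀ → EvenLinkRemovable j₀ t₀ (even-link-splice j₀ t₀)
even-link-removable zero zero = _
even-link-removable zero (suc zero) = _
even-link-removable (suc zero) zero = _
even-link-removable (suc zero) (suc zero) = _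
even-link-removable (suc (suc zero)) zero = _
even-link-removable (suc (suc zero)) (suc zero) = _

odd-link-splice : Fin 3 → Fin 2 → Splice
odd-link-splice zero zero = through (tri 0 1 0) (tri 1 0 1) (tri 2 0 0) (tri 0 2 2) (tri 2 0 0)
odd-link-splice zero (suc zero) = through (tri 0 1 0) (tri 1 0 1) (tri 1 0 0) (tri 0 1 1) (tri 1 0 0)
odd-link-splice (suc zero) zero = through (tri 0 0 1) (tri 1 1 0) (tri 0 2 0) (tri 2 0 2) (tri 0 2 0)
odd-link-splice (suc zero) (suc zero) = through (tri 0 0 1) (tri 1 1 0) (tri 0 1 0) (tri 1 0 1) (tri 0 1 0)
odd-link-splice (suc (suc zero)) zero = through (tri 0 1 1) (tri 1 0 0) (tri 1 1 2) (tri 2 2 1) (tri 1 1 2)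
odd-link-splice (suc (suc zero)) (suc zero) = through (tri 0 1 1) (tri 1 0 0) (tri 0 1 0) (tri 1 0 1) (tri 0 1 0)

odd-link-removable : ∀ j₀ t₀ → OddLinkRemovable j₀ t₀ (odd-link-splice j₀ t₀)
odd-link-removable zero zero = _
odd-link-removable zero (suc zero) = _
odd-link-removable (suc zero) zero = _
odd-link-removable (suc zero) (suc zero) = _
odd-link-removable (suc (suc zero)) zero = _
odd-link-removable (suc (suc zero)) (suc zero) = _

new-splice : Fin 3 → Splice
new-splice zero = through (tri 0 0 1) (tri 1 1 0) (tri 0 0 1) (tri 1 1 0) (tri 0 0 1)
new-splice (suc zero) = through (tri 0 1 1) (tri 1 0 0) (tri 0 1 1) (tri 1 0 0) (tri 0 1 1)
new-splice (suc (suc zero)) = through (tri 0 1 0) (tri 1 0 1) (tri 0 1 0) (tri 1 0 1) (tri 0 1 0)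

new-removable : ∀ j₀ → NewRemovable j₀ (new-splice j₀)
new-removable zero = _
new-removable (suc zero) = _
new-removable (suc (suc zero)) = _

lemma4p2 : (k : ℕ) → 1 ≤ k → MinimalUncolorable (vtx-≟ (suc (2 * k))) (H k)
lemma4p2 (suc k) _ = uncolourable , proper-subhypergraphs-colourable (each⇒all record
  { on-layer = without-layer layer-splice-removable
  ; on-link  = λ q j t → without-link (even-link-removable j t) (odd-link-removable j t) q
  ; on-new   = λ j → without-new (new-removable j)
  })
  where open Layered k
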